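{- For $r\ge0$ let $v_r(n)$ be the number of permutations of $[n]$ containing exactly $r$ occurrences of the pattern $23\text{ - }1$, and $V_r(x)=\sum_{n\ge0}v_r(n)x^n$. Then, as formal power series, $$V_2(x)=\frac{x}{1-x}\left(V_2\Bigl(\frac{x}{1-x}\Bigr)+(1-2x)V_1\Bigl(\frac{x}{1-x}\Bigr)+(1-3x+x^2)V_0\Bigl(\frac{x}{1-x}\Bigr)\right)-x+x^2.$$
   Context: An occurrence of the pattern $23\text{ - }1$ in a permutation $a_1a_2\cdots a_n$ is a pair of indices $(i,j)$ with $1\le i$, $i+1<j\le n$, such that $a_j<a_i<a_{i+1}$. The empty permutation (n=0) has no occurrences, so $v_0(0)=1$. -}

module Defs where

open import Data.Nat using (ℕ; zero; suc; _∸_)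
open import Data.Fin using (Fin; toℕ)
open import Data.Fin.Properties using (_≟_)
import Data.Fin as F
open import Data.List using (List; []; _∷_; length; filter; concatMap; map; allFin)
open import Data.Integer using (ℤ; +_; _+_; _*_; _-_; -_)
import Data.Nat as N
import Data.Nat.Properties as NP
open import Relation.Nullary.Decidable using (yes; no)
import Data.List.Relation.Unary.Unique.DecPropositional as UDec

words : (n k : ℕ) → List (List (Fin n))
words n zero    = [] ∷ []
words n (suc k) = concatMap (λ w → map (λ a → a ∷ w) (allFin n)) (words n k)

-- Permutations of [n] (written in one-line notation, values relabelled
-- 1..n ↦ 0..n-1): words of length n over Fin n with pairwise distinct letters.
perms : (n : ℕ) → List (List (Fin n))
perms n = filter (UDec.unique? _≟_) (words n n)

countBelow : {n : ℕ} → Fin n → List (Fin n) → ℕ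
countBelow a [] = 0
countBelow a (c ∷ cs) with toℕ c N.<? toℕ a
... | yes _ = suc (countBelow a cs)
... | no  _ = countBelow a cs

occAt : {n : ℕ} → Fin n → Fin n → List (Fin n) → ℕ
occAt a b rest with toℕ a N.<? toℕ b
... | yes _ = countBelow a rest
... | no  _ = 0

-- number of occurrences of 23-1: pairs (i,j) with i+1<j and a_j < a_i < a_{i+1}
occ : {n : ℕ} → List (Fin n) → ℕ
occ [] = 0
occ (a ∷ []) = 0
occ (a ∷ b ∷ rest) = occAt a b rest N.+ occ (b ∷ rest)

v : ℕ → ℕ → ℕ
v r n = length (filter (λ w → occ w NP.≟ r) (perms n))

Series : Set
Series = ℕ → ℤ

sumTo : ℕ → (ℕ → ℤ) → ℤ
sumTo zero    f = f 0
sumTo (suc n) f = sumTo n f + f (suc n)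

infixl 6 _⊕_ _⊖_
infixl 7 _⊛_

_⊕_ : Series → Series → Series
(F ⊕ G) n = F n + G n

_⊖_ : Series → Series → Series
(F ⊖ G) n = F n - G n

_⊛_ : Series → Series → Series
(F ⊛ G) n = sumTo n (λ k → F k * G (n ∸ k))

one : Series
one zero    = + 1
one (suc _) = + 0

pow : Series → ℕ → Series
pow G zero    = one
pow G (suc k) = G ⊛ pow G k

-- Composition F(G(x)), for G with zero constant term:
-- [x^n] F(G) = Σ_{k=0}^{n} f_k [x^n] G^k
compose : Series → Series → Series
compose F G n = sumTo n (λ k → F k * pow G k n)

poly : List ℤ → Series
poly []       n       = + 0
poly (c ∷ cs) zero    = c
poly (c ∷ cs) (suc n) = poly cs n

xOver1-x : Series
xOver1-x zero    = + 0
xOver1-x (suc _) = + 1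

V : ℕ → Series
V r n = + v r n

module Submission where

-- Split a permutation of [n+1] into its first letter m and the standardised rest, a
-- permutation of [n].  An occurrence (1, j) of 23-1 exists only when m lies below the second
-- letter, and then every smaller letter comes later, so there are exactly m of them.  Hence
-- the numbers v_r(n; m) of permutations with first letter m satisfy
--   v_r(n+1; m) = Σ_{t<m} v_r(n; t) + [m ≤ r] (v_{r-m}(n) - Σ_{t<m} v_{r-m}(n; t)).
-- For r = 2 the inhomogeneous term lives in the columns m = 0, 1, 2, where (up to a boundary
-- term) it is the coefficient sequence of V_2, (1-x) V_1 and (1-x-x²) V_0.  Iterated partial
-- sums solve the recurrence with the binomial kernels [x^t] y^k, y = x/(1-x).  Summing a row,
-- reflecting the binomials and summing by parts yields the factors 1-2x = (1-x)(1-y) and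
-- 1-3x+x² = (1-x)²(1-y-y²) of the right-hand side.

open import Defs

open import Data.Empty using (⊥-elim)
open import Data.Fin using (Fin; zero; suc; toℕ; punchIn; punchOut; fromℕ<)
import Data.Fin.Properties as Finₚ
open import Data.Integer using (ℤ; +_; -_; 0ℤ; 1ℤ; _+_; _-_; _*_)
import Data.Integer.Properties as ℤₚ
open import Data.Integer.Tactic.RingSolver using (solve-∀)
open import Data.List using (List; []; _∷_; _++_; length; map; concatMap; filter; allFin; cartesianProductWith)
import Data.List.Properties as Listₚ
open import Data.List.Membership.Propositional using (_∈_)
import Data.List.Membership.Propositional.Properties as ∈ₚ
open import Data.List.Membership.Propositional.Properties.WithK using (unique∧set⇒bag)
open import Data.List.Relation.Binary.BagAndSetEquality using (∼bag⇒↭)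
open import Data.List.Relation.Binary.Permutation.Propositional using (_↭_)
open import Data.List.Relation.Binary.Permutation.Propositional.Properties using (↭-length; filter-↭)
open import Data.List.Relation.Unary.All as All using (All; []; _∷_)
import Data.List.Relation.Unary.All.Properties as Allₚ
open import Data.List.Relation.Unary.Any using (here; there)
open import Data.List.Relation.Unary.Unique.DecPropositional using (unique?)
open import Data.List.Relation.Unary.Unique.Propositional using (Unique; []; _∷_)
import Data.List.Relation.Unary.Unique.Propositional.Properties as Uniqueₚ
open import Data.Nat as N using (ℕ; zero; suc; _∸_; _≤_; _<_; z≤n; s≤s)
open import Data.Nat.Combinatorics using (_C_; nCk≡nC[n∸k]; nCk+nC[k+1]≡[n+1]C[k+1]; k>n⇒nCk≡0)
open import Data.Nat.ListAction using (sum)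
import Data.Nat.Properties as ℕₚ
open import Data.Product as Product using (_×_; _,_; proj₁; proj₂; uncurry)
open import Function using (_∘_; id; flip)
open import Function.Bundles using (_⇔_; mk⇔; Equivalence)
open import Relation.Binary.PropositionalEquality
  using (_≡_; _≢_; refl; sym; trans; cong; cong₂; subst; module ≡-Reasoning)
open import Relation.Nullary using (¬_; yes; no)
open import Relation.Unary using (Pred; Decidable)
open import Relation.Unary.Properties using (_∩?_; ∁?)

-- Finite sums and counting

Σ< : ℕ → (ℕ → ℤ) → ℤ
Σ< zero    f = 0ℤ
Σ< (suc n) f = Σ< n f + f n

sumTo≡Σ< : ∀ n f → sumTo n f ≡ Σ< (suc n) f
sumTo≡Σ< zero    f = sym (ℤₚ.+-identityˡ (f 0))
sumTo≡Σ< (suc n) f = cong (_+ f (suc n)) (sumTo≡Σ< n f)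

Σ<-cong : ∀ n {f g : ℕ → ℤ} → (∀ i → i < n → f i ≡ g i) → Σ< n f ≡ Σ< n g
Σ<-cong zero    eq = refl
Σ<-cong (suc n) eq = cong₂ _+_ (Σ<-cong n (λ i i<n → eq i (ℕₚ.m<n⇒m<1+n i<n))) (eq n ℕₚ.≤-refl)

Σ<-zero : ∀ n {f : ℕ → ℤ} → (∀ i → i < n → f i ≡ 0ℤ) → Σ< n f ≡ 0ℤ
Σ<-zero zero    eq = refl
Σ<-zero (suc n) eq = cong₂ _+_ (Σ<-zero n (λ i i<n → eq i (ℕₚ.m<n⇒m<1+n i<n))) (eq n ℕₚ.≤-refl)

Σ<-distrib-+ : ∀ n (f g : ℕ → ℤ) → Σ< n (λ i → f i + g i) ≡ Σ< n f + Σ< n g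
Σ<-distrib-+ zero    f g = refl
Σ<-distrib-+ (suc n) f g =
  trans (cong (_+ (f n + g n)) (Σ<-distrib-+ n f g)) (interchange (Σ< n f) (Σ< n g) (f n) (g n))
  where
  interchange : ∀ a b c d → a + b + (c + d) ≡ a + c + (b + d)
  interchange = solve-∀

Σ<-distrib-- : ∀ n (f g : ℕ → ℤ) → Σ< n (λ i → f i - g i) ≡ Σ< n f - Σ< n g
Σ<-distrib-- zero    f g = refl
Σ<-distrib-- (suc n) f g =
  trans (cong (_+ (f n - g n)) (Σ<-distrib-- n f g)) (interchange (Σ< n f) (Σ< n g) (f n) (g n))
  where
  interchange : ∀ a b c d → a - b + (c - d) ≡ a + c - (b + d)
  interchange = solve-∀

Σ<-*ˡ : ∀ n c (f : ℕ → ℤ) → Σ< n (λ i → c * f i) ≡ c * Σ< n f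
Σ<-*ˡ zero    c f = sym (ℤₚ.*-zeroʳ c)
Σ<-*ˡ (suc n) c f = trans (cong (_+ c * f n) (Σ<-*ˡ n c f)) (sym (ℤₚ.*-distribˡ-+ c (Σ< n f) (f n)))

Σ<-head : ∀ n (f : ℕ → ℤ) → Σ< (suc n) f ≡ f 0 + Σ< n (f ∘ suc)
Σ<-head zero    f = ℤₚ.+-comm 0ℤ (f 0)
Σ<-head (suc n) f =
  trans (cong (_+ f (suc n)) (Σ<-head n f)) (ℤₚ.+-assoc (f 0) (Σ< n (f ∘ suc)) (f (suc n)))

Σ<-comm : ∀ m n (f : ℕ → ℕ → ℤ) → Σ< m (λ i → Σ< n (f i)) ≡ Σ< n (λ j → Σ< m (λ i → f i j))
Σ<-comm zero    n f = sym (Σ<-zero n (λ _ _ → refl))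
Σ<-comm (suc m) n f = trans (cong (_+ Σ< n (f m)) (Σ<-comm m n f)) (sym (Σ<-distrib-+ n _ (f m)))

Σ<-reverse : ∀ n (f : ℕ → ℤ) → Σ< n (λ i → f (n ∸ suc i)) ≡ Σ< n f
Σ<-reverse zero    f = refl
Σ<-reverse (suc n) f = begin
  Σ< (suc n) (λ i → f (n ∸ i))     ≡⟨ Σ<-head n _ ⟩
  f n + Σ< n (λ i → f (n ∸ suc i)) ≡⟨ cong (λ s → f n + s) (Σ<-reverse n f) ⟩
  f n + Σ< n f                     ≡⟨ ℤₚ.+-comm (f n) (Σ< n f) ⟩
  Σ< (suc n) f                     ∎
  where open ≡-Reasoning

Σ<-extend : ∀ {m n} (f : ℕ → ℤ) → m ≤ n → (∀ i → m ≤ i → i < n → f i ≡ 0ℤ) → Σ< n f ≡ Σ< m f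
Σ<-extend {n = zero}  f z≤n   eq = refl
Σ<-extend {m} {suc n} f m≤1+n eq with m ℕₚ.≟ suc n
... | yes refl = refl
... | no m≢1+n =
  trans (cong₂ _+_ (Σ<-extend f m≤n (λ i m≤i i<n → eq i m≤i (ℕₚ.m<n⇒m<1+n i<n))) (eq n m≤n ℕₚ.≤-refl))
        (ℤₚ.+-identityʳ (Σ< m f))
  where m≤n = ℕₚ.≤-pred (ℕₚ.≤∧≢⇒< m≤1+n m≢1+n)

count : ∀ {a p} {A : Set a} {P : Pred A p} → Decidable P → List A → ℕ
count P? xs = length (filter P? xs)

module _ {a p} {A : Set a} {P : Pred A p} (P? : Decidable P) {x : A} {xs : List A} where

  count-accept : P x → count P? (x ∷ xs) ≡ suc (count P? xs)
  count-accept px = cong length (Listₚ.filter-accept P? px)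

  count-reject : ¬ P x → count P? (x ∷ xs) ≡ count P? xs
  count-reject ¬px = cong length (Listₚ.filter-reject P? ¬px)

count-none : ∀ {a p} {A : Set a} {P : Pred A p} (P? : Decidable P) xs →
  (∀ {x} → x ∈ xs → ¬ P x) → count P? xs ≡ 0
count-none P? []       ¬P = refl
count-none P? (x ∷ xs) ¬P with P? x
... | yes px = ⊥-elim (¬P (here refl) px)
... | no  _  = count-none P? xs (λ x∈ → ¬P (there x∈))

module _ {a p q} {A : Set a} {P : Pred A p} {Q : Pred A q} (P? : Decidable P) (Q? : Decidable Q) where

  count-cong : ∀ xs → (∀ {x} → x ∈ xs → P x ⇔ Q x) → count P? xs ≡ count Q? xs
  count-cong []       P⇔Q = refl
  count-cong (x ∷ xs) P⇔Q with P? x | Q? x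
  ... | yes px | yes qx = cong suc (count-cong xs (λ x∈ → P⇔Q (there x∈)))
  ... | yes px | no ¬qx = ⊥-elim (¬qx (Equivalence.to (P⇔Q (here refl)) px))
  ... | no ¬px | yes qx = ⊥-elim (¬px (Equivalence.from (P⇔Q (here refl)) qx))
  ... | no ¬px | no ¬qx = count-cong xs (λ x∈ → P⇔Q (there x∈))

  count-split : ∀ xs → count P? xs ≡ count (P? ∩? Q?) xs N.+ count (P? ∩? ∁? Q?) xs
  count-split []       = refl
  count-split (x ∷ xs) with P? x | Q? x
  ... | yes _ | yes _ = cong suc (count-split xs)
  ... | yes _ | no  _ = trans (cong suc (count-split xs)) (sym (ℕₚ.+-suc _ _))
  ... | no  _ | _     = count-split xs

module _ {a b p} {A : Set a} {B : Set b} {P : Pred B p} (P? : Decidable P) where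

  count-map : ∀ (f : A → B) xs → count P? (map f xs) ≡ count (P? ∘ f) xs
  count-map f []       = refl
  count-map f (x ∷ xs) with P? (f x)
  ... | yes _ = cong suc (count-map f xs)
  ... | no  _ = count-map f xs

  count-cartesianProductWith : ∀ {c} {C : Set c} (f : C → A → B) xs ys →
    count P? (cartesianProductWith f xs ys) ≡ sum (map (λ x → count (P? ∘ f x) ys) xs)
  count-cartesianProductWith f []       ys = refl
  count-cartesianProductWith f (x ∷ xs) ys = begin
    length (filter P? (map (f x) ys ++ cartesianProductWith f xs ys))
      ≡⟨ cong length (Listₚ.filter-++ P? (map (f x) ys) _) ⟩
    length (filter P? (map (f x) ys) ++ filter P? (cartesianProductWith f xs ys))
      ≡⟨ Listₚ.length-++ (filter P? (map (f x) ys)) ⟩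
    count P? (map (f x) ys) N.+ count P? (cartesianProductWith f xs ys)
      ≡⟨ cong₂ N._+_ (count-map (f x) ys) (count-cartesianProductWith f xs ys) ⟩
    sum (map (λ x → count (P? ∘ f x) ys) (x ∷ xs)) ∎
    where open ≡-Reasoning

module _ {a p} {A : Set a} {P : Pred A p} (P? : Decidable P) where

  count-<-Σ< : ∀ (f : A → ℕ) m xs →
    + count (P? ∩? (λ x → f x N.<? m)) xs ≡ Σ< m (λ t → + count (P? ∩? (λ x → f x ℕₚ.≟ t)) xs)
  count-<-Σ< f zero    xs = cong +_ (count-none _ xs (λ { _ (_ , ()) }))
  count-<-Σ< f (suc m) xs = begin
    + count (P? ∩? below (suc m)) xs
      ≡⟨ cong +_ (count-split (P? ∩? below (suc m)) (below m) xs) ⟩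
    + (count ((P? ∩? below (suc m)) ∩? below m) xs N.+ count ((P? ∩? below (suc m)) ∩? ∁? (below m)) xs)
      ≡⟨ ℤₚ.pos-+ (count ((P? ∩? below (suc m)) ∩? below m) xs) _ ⟩
    + count ((P? ∩? below (suc m)) ∩? below m) xs + + count ((P? ∩? below (suc m)) ∩? ∁? (below m)) xs
      ≡⟨ cong₂ _+_ (cong +_ (count-cong _ _ xs (λ _ → lower))) (cong +_ (count-cong _ _ xs (λ _ → top))) ⟩
    + count (P? ∩? below m) xs + + count (P? ∩? at m) xs
      ≡⟨ cong (_+ + count (P? ∩? at m) xs) (count-<-Σ< f m xs) ⟩
    Σ< (suc m) (λ t → + count (P? ∩? at t) xs) ∎
    where
    open ≡-Reasoning
    below : ∀ k → Decidable (λ x → f x < k)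
    below k x = f x N.<? k
    at : ∀ k → Decidable (λ x → f x ≡ k)
    at k x = f x ℕₚ.≟ k
    lower : ∀ {x} → ((P x × f x < suc m) × f x < m) ⇔ (P x × f x < m)
    lower = mk⇔ (λ ((px , _) , lt) → px , lt) (λ (px , lt) → (px , ℕₚ.m<n⇒m<1+n lt) , lt)
    top : ∀ {x} → ((P x × f x < suc m) × ¬ f x < m) ⇔ (P x × f x ≡ m)
    top = mk⇔ (λ ((px , lt) , ¬lt) → px , ℕₚ.≤-antisym (ℕₚ.≤-pred lt) (ℕₚ.≮⇒≥ ¬lt))
              (λ { (px , refl) → (px , ℕₚ.≤-refl) , ℕₚ.n≮n _ })

sum-map-zero : ∀ {a} {A : Set a} (f : A → ℕ) {xs} → (∀ {x} → x ∈ xs → f x ≡ 0) → sum (map f xs) ≡ 0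
sum-map-zero f {[]}     f≡0 = refl
sum-map-zero f {x ∷ xs} f≡0 = cong₂ N._+_ (f≡0 (here refl)) (sum-map-zero f (λ x∈ → f≡0 (there x∈)))

sum-map-single : ∀ {a} {A : Set a} (f : A → ℕ) {xs x₀} → Unique xs → x₀ ∈ xs →
  (∀ {x} → x ∈ xs → x ≢ x₀ → f x ≡ 0) → sum (map f xs) ≡ f x₀
sum-map-single f (x∉ ∷ _) (here refl) f≡0 =
  trans (cong (f _ N.+_) (sum-map-zero f (λ x∈ → f≡0 (there x∈) (λ eq → All.lookup x∉ x∈ (sym eq)))))
        (ℕₚ.+-identityʳ _)
sum-map-single f (x∉ ∷ u) (there x₀∈) f≡0 =
  cong₂ N._+_ (f≡0 (here refl) (All.lookup x∉ x₀∈)) (sum-map-single f u x₀∈ (λ x∈ → f≡0 (there x∈)))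

-- Permutations by first-letter insertion

insertHead : ∀ {n} → Fin (suc n) → List (Fin n) → List (Fin (suc n))
insertHead a τ = a ∷ map (punchIn a) τ

permutations : (n : ℕ) → List (List (Fin n))
permutations zero    = [] ∷ []
permutations (suc n) = cartesianProductWith insertHead (allFin (suc n)) (permutations n)

insertHead-injective : ∀ {n} {a b : Fin (suc n)} {τ σ} → insertHead a τ ≡ insertHead b σ → a ≡ b × τ ≡ σ
insertHead-injective {a = a} eq with Listₚ.∷-injective eq
... | refl , τ≡σ = refl , Listₚ.map-injective (Finₚ.punchIn-injective a _ _) τ≡σ

insertHead-unique : ∀ {n} (a : Fin (suc n)) {τ} → Unique τ → Unique (insertHead a τ)
insertHead-unique a u =
  Allₚ.map⁺ (All.tabulate (λ _ eq → Finₚ.punchInᵢ≢i a _ (sym eq))) ∷ Uniqueₚ.map⁺ (Finₚ.punchIn-injective a _ _) u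

permutations-unique : ∀ n → Unique (permutations n)
permutations-unique zero    = [] ∷ []
permutations-unique (suc n) =
  Uniqueₚ.cartesianProductWith⁺ insertHead insertHead-injective (Uniqueₚ.allFin⁺ (suc n)) (permutations-unique n)

∈-permutations⁻ : ∀ n {w} → w ∈ permutations n → Unique w × length w ≡ n
∈-permutations⁻ zero    (here refl) = [] , refl
∈-permutations⁻ (suc n) w∈ with ∈ₚ.∈-cartesianProductWith⁻ insertHead (allFin (suc n)) (permutations n) w∈
... | a , τ , _ , τ∈ , refl with ∈-permutations⁻ n τ∈
... | u , len = insertHead-unique a u , cong suc (trans (Listₚ.length-map (punchIn a) τ) len)

map-punchIn-punchOut : ∀ {n} {a : Fin (suc n)} {xs} (a∉ : All (a ≢_) xs) →
  map (punchIn a) (All.reduce punchOut a∉) ≡ xs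
map-punchIn-punchOut []         = refl
map-punchIn-punchOut (a≢x ∷ a∉) = cong₂ _∷_ (Finₚ.punchIn-punchOut a≢x) (map-punchIn-punchOut a∉)

∈-permutations⁺ : ∀ n {w} → Unique w → length w ≡ n → w ∈ permutations n
∈-permutations⁺ zero    {[]}     _        _   = here refl
∈-permutations⁺ (suc n) {a ∷ xs} (a∉ ∷ u) len =
  subst (λ ys → a ∷ ys ∈ permutations (suc n)) (map-punchIn-punchOut a∉)
    (∈ₚ.∈-cartesianProductWith⁺ insertHead (∈ₚ.∈-allFin a) (∈-permutations⁺ n τ-unique τ-length))
  where
  τ = All.reduce punchOut a∉
  τ-unique : Unique τ
  τ-unique = Uniqueₚ.map⁻ (subst Unique (sym (map-punchIn-punchOut a∉)) u)
  τ-length : length τ ≡ n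
  τ-length = trans (sym (Listₚ.length-map (punchIn a) τ))
                   (trans (cong length (map-punchIn-punchOut a∉)) (ℕₚ.suc-injective len))

words-suc : ∀ n k → words n (suc k) ≡ cartesianProductWith (flip _∷_) (words n k) (allFin n)
words-suc n k = go (words n k)
  where
  go : ∀ ws → concatMap (λ w → map (λ a → a ∷ w) (allFin n)) ws ≡ cartesianProductWith (flip _∷_) ws (allFin n)
  go []       = refl
  go (w ∷ ws) = cong (map (λ a → a ∷ w) (allFin n) ++_) (go ws)

∈-words⁻ : ∀ n k {w} → w ∈ words n k → length w ≡ k
∈-words⁻ n zero    (here refl) = refl
∈-words⁻ n (suc k) w∈
  with ∈ₚ.∈-cartesianProductWith⁻ (flip _∷_) (words n k) (allFin n) (subst (_ ∈_) (words-suc n k) w∈)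
... | w , a , w∈′ , _ , refl = cong suc (∈-words⁻ n k w∈′)

∈-words⁺ : ∀ n k (w : List (Fin n)) → length w ≡ k → w ∈ words n k
∈-words⁺ n zero    []      _   = here refl
∈-words⁺ n (suc k) (a ∷ w) len = subst (a ∷ w ∈_) (sym (words-suc n k))
  (∈ₚ.∈-cartesianProductWith⁺ (flip _∷_) (∈-words⁺ n k w (ℕₚ.suc-injective len)) (∈ₚ.∈-allFin a))

words-unique : ∀ n k → Unique (words n k)
words-unique n zero    = [] ∷ []
words-unique n (suc k) = subst Unique (sym (words-suc n k))
  (Uniqueₚ.cartesianProductWith⁺ (flip _∷_) ∷-injective′ (words-unique n k) (Uniqueₚ.allFin⁺ n))
  where
  ∷-injective′ : ∀ {w w′ : List (Fin n)} {a a′} → a ∷ w ≡ a′ ∷ w′ → w ≡ w′ × a ≡ a′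
  ∷-injective′ refl = refl , refl

module _ (n : ℕ) where

  private
    unique-Fin? = unique? {A = Fin n} Finₚ._≟_

  perms-unique : Unique (perms n)
  perms-unique = Uniqueₚ.filter⁺ unique-Fin? (words-unique n n)

  ∈-perms⁻ : ∀ {w} → w ∈ perms n → Unique w × length w ≡ n
  ∈-perms⁻ w∈ with ∈ₚ.∈-filter⁻ unique-Fin? w∈
  ... | w∈words , u = u , ∈-words⁻ n n w∈words

  ∈-perms⁺ : ∀ {w} → Unique w → length w ≡ n → w ∈ perms n
  ∈-perms⁺ {w} u len = ∈ₚ.∈-filter⁺ unique-Fin? (∈-words⁺ n n w len) u

  perms↭permutations : perms n ↭ permutations n
  perms↭permutations = ∼bag⇒↭ (unique∧set⇒bag perms-unique (permutations-unique n)
    (mk⇔ (uncurry (∈-permutations⁺ n) ∘ ∈-perms⁻) (uncurry ∈-perms⁺ ∘ ∈-permutations⁻ n)))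

occ≟ : ∀ {n} r → Decidable (λ (w : List (Fin n)) → occ w ≡ r)
occ≟ r w = occ w ℕₚ.≟ r

v≡count-permutations : ∀ r n → v r n ≡ count (occ≟ r) (permutations n)
v≡count-permutations r n = ↭-length (filter-↭ (occ≟ r) (perms↭permutations n))

-- Refinement by the first letter

-- The empty word gets 0: only the empty permutation has no first letter.
first : ∀ {n} → List (Fin n) → ℕ
first []      = 0
first (a ∷ _) = toℕ a

below? : ∀ {n} k → Decidable (λ (c : Fin n) → toℕ c < k)
below? k c = toℕ c N.<? k

countBelow≡count : ∀ {n} (a : Fin n) xs → countBelow a xs ≡ count (below? (toℕ a)) xs
countBelow≡count a []       = refl
countBelow≡count a (c ∷ cs) with toℕ c N.<? toℕ a
... | yes c<a = trans (cong suc (countBelow≡count a cs)) (sym (count-accept (below? (toℕ a)) c<a))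
... | no  c≮a = trans (countBelow≡count a cs) (sym (count-reject (below? (toℕ a)) c≮a))

module _ {m n} (f : Fin m → Fin n) (f-embedding : ∀ {x y} → (toℕ (f x) < toℕ (f y)) ⇔ (toℕ x < toℕ y)) where

  occAt-map : ∀ a b rest → occAt (f a) (f b) (map f rest) ≡ occAt a b rest
  occAt-map a b rest with toℕ (f a) N.<? toℕ (f b) | toℕ a N.<? toℕ b
  ... | yes _     | yes _   = begin
    countBelow (f a) (map f rest)            ≡⟨ countBelow≡count (f a) (map f rest) ⟩
    count (below? (toℕ (f a))) (map f rest)  ≡⟨ count-map _ f rest ⟩
    count (below? (toℕ (f a)) ∘ f) rest      ≡⟨ count-cong _ _ rest (λ _ → f-embedding) ⟩
    count (below? (toℕ a)) rest              ≡⟨ countBelow≡count a rest ⟨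
    countBelow a rest                        ∎
    where open ≡-Reasoning
  ... | yes fa<fb | no a≮b  = ⊥-elim (a≮b (Equivalence.to f-embedding fa<fb))
  ... | no fa≮fb  | yes a<b = ⊥-elim (fa≮fb (Equivalence.from f-embedding a<b))
  ... | no  _     | no  _   = refl

  occ-map : ∀ τ → occ (map f τ) ≡ occ τ
  occ-map []             = refl
  occ-map (a ∷ [])       = refl
  occ-map (a ∷ b ∷ rest) = cong₂ N._+_ (occAt-map a b rest) (occ-map (b ∷ rest))

punchIn-< : ∀ {n} (i : Fin (suc n)) j → toℕ j < toℕ i → toℕ (punchIn i j) ≡ toℕ j
punchIn-< (suc i) zero    _         = refl
punchIn-< (suc i) (suc j) (s≤s j<i) = cong suc (punchIn-< i j j<i)

punchIn-≥ : ∀ {n} (i : Fin (suc n)) j → toℕ i ≤ toℕ j → toℕ (punchIn i j) ≡ suc (toℕ j)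
punchIn-≥ zero    j       _         = refl
punchIn-≥ (suc i) (suc j) (s≤s i≤j) = cong suc (punchIn-≥ i j i≤j)

punchIn-embedding : ∀ {n} (i : Fin (suc n)) {x y} → (toℕ (punchIn i x) < toℕ (punchIn i y)) ⇔ (toℕ x < toℕ y)
punchIn-embedding i {x} {y} = mk⇔
  (λ lt → ℕₚ.≰⇒> (λ y≤x → ℕₚ.<⇒≱ lt (Finₚ.punchIn-mono-≤ i y x y≤x)))
  (λ lt → ℕₚ.≰⇒> (λ y≤x → ℕₚ.<⇒≱ lt (Finₚ.punchIn-cancel-≤ i y x y≤x)))

punchIn-<-below : ∀ {n} (i : Fin (suc n)) j {k} → k ≤ toℕ i → (toℕ (punchIn i j) < k) ⇔ (toℕ j < k)
punchIn-<-below i j {k} k≤i with toℕ j N.<? toℕ i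
... | yes j<i = subst (λ t → (t < k) ⇔ (toℕ j < k)) (sym (punchIn-< i j j<i)) (mk⇔ id id)
... | no  j≮i = mk⇔ (λ lt → ⊥-elim (ℕₚ.<⇒≱ lt k≤i′))
                    (λ lt → ⊥-elim (ℕₚ.<⇒≱ lt k≤j))
  where
  i≤j = ℕₚ.≮⇒≥ j≮i
  k≤j = ℕₚ.≤-trans k≤i i≤j
  k≤i′ = subst (k ≤_) (sym (punchIn-≥ i j i≤j)) (ℕₚ.m≤n⇒m≤1+n k≤j)

punchIn-<-above : ∀ {n} (i : Fin (suc n)) j {k} → toℕ i ≤ k → (toℕ (punchIn i j) < suc k) ⇔ (toℕ j < k)
punchIn-<-above i j {k} i≤k with toℕ j N.<? toℕ i
... | yes j<i = mk⇔ (λ _ → j<k) (λ _ → subst (_< suc k) (sym (punchIn-< i j j<i)) (ℕₚ.m<n⇒m<1+n j<k))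
  where j<k = ℕₚ.<-≤-trans j<i i≤k
... | no  j≮i =
  subst (λ t → (t < suc k) ⇔ (toℕ j < k)) (sym (punchIn-≥ i j (ℕₚ.≮⇒≥ j≮i))) (mk⇔ ℕₚ.≤-pred s≤s)

count-<-permutation : ∀ n {w} → w ∈ permutations n → ∀ k → k ≤ n → count (below? k) w ≡ k
count-<-permutation zero    (here refl) zero    z≤n       = refl
count-<-permutation (suc n) {w} w∈      zero    _         = count-none _ w (λ _ ())
count-<-permutation (suc n) w∈          (suc k) (s≤s k≤n)
  with ∈ₚ.∈-cartesianProductWith⁻ insertHead (allFin (suc n)) (permutations n) w∈
... | a , σ , _ , σ∈ , refl with toℕ a N.<? suc k
...   | yes a<1+k = begin
  count (below? (suc k)) (insertHead a σ)          ≡⟨ count-accept (below? (suc k)) a<1+k ⟩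
  suc (count (below? (suc k)) (map (punchIn a) σ)) ≡⟨ cong suc (count-map (below? (suc k)) (punchIn a) σ) ⟩
  suc (count (below? (suc k) ∘ punchIn a) σ)
    ≡⟨ cong suc (count-cong _ _ σ (λ _ → punchIn-<-above a _ (ℕₚ.≤-pred a<1+k))) ⟩
  suc (count (below? k) σ)                         ≡⟨ cong suc (count-<-permutation n σ∈ k k≤n) ⟩
  suc k                                            ∎
  where open ≡-Reasoning
...   | no a≮1+k = begin
  count (below? (suc k)) (insertHead a σ)     ≡⟨ count-reject (below? (suc k)) a≮1+k ⟩
  count (below? (suc k)) (map (punchIn a) σ)  ≡⟨ count-map (below? (suc k)) (punchIn a) σ ⟩
  count (below? (suc k) ∘ punchIn a) σ        ≡⟨ count-cong _ _ σ (λ _ → punchIn-<-below a _ 1+k≤a) ⟩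
  count (below? (suc k)) σ
    ≡⟨ count-<-permutation n σ∈ (suc k) (ℕₚ.≤-trans 1+k≤a (ℕₚ.≤-pred (Finₚ.toℕ<n a))) ⟩
  suc k                                       ∎
  where
  open ≡-Reasoning
  1+k≤a = ℕₚ.≮⇒≥ a≮1+k

occ-insertHead-< : ∀ {n} (a : Fin (suc n)) τ → first τ < toℕ a → occ (insertHead a τ) ≡ occ τ
occ-insertHead-< a []         _   = refl
occ-insertHead-< a (b ∷ rest) b<a with toℕ a N.<? toℕ (punchIn a b)
... | yes a<b′ = ⊥-elim (ℕₚ.<-asym b<a (subst (toℕ a <_) (punchIn-< a b b<a) a<b′))
... | no  _    = occ-map (punchIn a) (punchIn-embedding a) (b ∷ rest)

-- Every letter below a comes after the second position, so a has exactly toℕ a partners.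
occ-insertHead-≥ : ∀ {n} (a : Fin (suc n)) {τ} → τ ∈ permutations n → toℕ a ≤ first τ →
  occ (insertHead a τ) ≡ occ τ N.+ toℕ a
occ-insertHead-≥ {zero}  zero {[]}       _  _ = refl
occ-insertHead-≥ {suc n} a    {[]}       τ∈ _ with () ← proj₂ (∈-permutations⁻ (suc n) τ∈)
occ-insertHead-≥ {n}     a    {b ∷ rest} τ∈ a≤b with toℕ a N.<? toℕ (punchIn a b)
... | no  a≮b′ = ⊥-elim (a≮b′ (subst (toℕ a <_) (sym (punchIn-≥ a b a≤b)) (s≤s a≤b)))
... | yes _    = trans (cong₂ N._+_ partners (occ-map (punchIn a) (punchIn-embedding a) (b ∷ rest)))
                       (ℕₚ.+-comm (toℕ a) (occ (b ∷ rest)))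
  where
  open ≡-Reasoning
  partners : countBelow a (map (punchIn a) rest) ≡ toℕ a
  partners = begin
    countBelow a (map (punchIn a) rest)            ≡⟨ countBelow≡count a (map (punchIn a) rest) ⟩
    count (below? (toℕ a)) (map (punchIn a) rest)  ≡⟨ count-map (below? (toℕ a)) (punchIn a) rest ⟩
    count (below? (toℕ a) ∘ punchIn a) rest        ≡⟨ count-cong _ _ rest (λ _ → punchIn-<-below a _ ℕₚ.≤-refl) ⟩
    count (below? (toℕ a)) rest                    ≡⟨ count-reject (below? (toℕ a)) (ℕₚ.≤⇒≯ a≤b) ⟨
    count (below? (toℕ a)) (b ∷ rest)              ≡⟨ count-<-permutation n τ∈ (toℕ a) (ℕₚ.≤-pred (Finₚ.toℕ<n a)) ⟩
    toℕ a                                          ∎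

first<? : ∀ {n} m → Decidable (λ (w : List (Fin n)) → first w < m)
first<? m w = first w N.<? m

first≟ : ∀ {n} m → Decidable (λ (w : List (Fin n)) → first w ≡ m)
first≟ m w = first w ℕₚ.≟ m

vFirst : ℕ → ℕ → ℕ → ℤ
vFirst r n m = + count (occ≟ r ∩? first≟ m) (permutations n)

first-permutation : ∀ n {w} → w ∈ permutations (suc n) → first w < suc n
first-permutation n w∈ with ∈ₚ.∈-cartesianProductWith⁻ insertHead (allFin (suc n)) (permutations n) w∈
... | a , _ , _ , _ , refl = Finₚ.toℕ<n a

V≡Σ<vFirst : ∀ r n → V r (suc n) ≡ Σ< (suc n) (vFirst r (suc n))
V≡Σ<vFirst r n = begin
  + v r (suc n)                           ≡⟨ cong +_ (v≡count-permutations r (suc n)) ⟩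
  + count (occ≟ r) ps                     ≡⟨ cong +_ (count-cong _ _ ps (λ w∈ → mk⇔ (_, first-permutation n w∈) proj₁)) ⟩
  + count (occ≟ r ∩? first<? (suc n)) ps  ≡⟨ count-<-Σ< (occ≟ r) first (suc n) ps ⟩
  Σ< (suc n) (vFirst r (suc n))           ∎
  where
  open ≡-Reasoning
  ps = permutations (suc n)

count-occ-first≥ : ∀ r n m → + count (occ≟ r ∩? ∁? (first<? m)) (permutations n) ≡ V r n - Σ< m (vFirst r n)
count-occ-first≥ r n m = begin
  late                                       ≡⟨ cancel early late ⟩
  early + late - early                       ≡⟨ cong (_- early) (ℤₚ.pos-+ (count (occ≟ r ∩? first<? m) ps) _) ⟨
  + (count (occ≟ r ∩? first<? m) ps N.+ count (occ≟ r ∩? ∁? (first<? m)) ps) - early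
                                             ≡⟨ cong (λ c → + c - early) (count-split (occ≟ r) (first<? m) ps) ⟨
  + count (occ≟ r) ps - early                ≡⟨ cong₂ _-_ (cong +_ (sym (v≡count-permutations r n)))
                                                          (count-<-Σ< (occ≟ r) first m ps) ⟩
  V r n - Σ< m (vFirst r n)                  ∎
  where
  open ≡-Reasoning
  ps = permutations n
  early = + count (occ≟ r ∩? first<? m) ps
  late = + count (occ≟ r ∩? ∁? (first<? m)) ps
  cancel : ∀ a b → b ≡ a + b - a
  cancel = solve-∀

count-insertHead : ∀ r n (a : Fin (suc n)) →
  count (occ≟ r ∩? first≟ (toℕ a)) (permutations (suc n)) ≡ count (occ≟ r ∘ insertHead a) (permutations n)
count-insertHead r n a = begin
  count (occ≟ r ∩? first≟ (toℕ a)) (cartesianProductWith insertHead (allFin (suc n)) ps)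
    ≡⟨ count-cartesianProductWith _ insertHead (allFin (suc n)) ps ⟩
  sum (map (λ b → count ((occ≟ r ∩? first≟ (toℕ a)) ∘ insertHead b) ps) (allFin (suc n)))
    ≡⟨ sum-map-single _ (Uniqueₚ.allFin⁺ (suc n)) (∈ₚ.∈-allFin a) other-heads ⟩
  count ((occ≟ r ∩? first≟ (toℕ a)) ∘ insertHead a) ps
    ≡⟨ count-cong _ _ ps (λ _ → mk⇔ proj₁ (_, refl)) ⟩
  count (occ≟ r ∘ insertHead a) ps ∎
  where
  open ≡-Reasoning
  ps = permutations n
  other-heads : ∀ {b} → b ∈ allFin (suc n) → b ≢ a → count ((occ≟ r ∩? first≟ (toℕ a)) ∘ insertHead b) ps ≡ 0
  other-heads _ b≢a = count-none _ ps (λ _ (_ , b≡a) → b≢a (Finₚ.toℕ-injective b≡a))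

vFirst-suc-split : ∀ r n m → m ≤ n →
  vFirst r (suc n) m ≡ Σ< m (vFirst r n) + + count ((λ τ → occ τ N.+ m ℕₚ.≟ r) ∩? ∁? (first<? m)) (permutations n)
vFirst-suc-split r n m m≤n = begin
  vFirst r (suc n) m
    ≡⟨ cong (vFirst r (suc n)) (sym a≡m) ⟩
  vFirst r (suc n) (toℕ a)
    ≡⟨ cong +_ (count-insertHead r n a) ⟩
  + count P? ps
    ≡⟨ cong +_ (count-split P? (first<? m) ps) ⟩
  + (count (P? ∩? first<? m) ps N.+ count (P? ∩? ∁? (first<? m)) ps)
    ≡⟨ ℤₚ.pos-+ (count (P? ∩? first<? m) ps) _ ⟩
  + count (P? ∩? first<? m) ps + + count (P? ∩? ∁? (first<? m)) ps
    ≡⟨ cong₂ _+_ (trans (cong +_ (count-cong _ _ ps (λ {τ} _ → early {τ}))) (count-<-Σ< (occ≟ r) first m ps))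
                 (cong +_ (count-cong _ _ ps late)) ⟩
  Σ< m (vFirst r n) + + count ((λ τ → occ τ N.+ m ℕₚ.≟ r) ∩? ∁? (first<? m)) ps ∎
  where
  open ≡-Reasoning
  ps = permutations n
  a : Fin (suc n)
  a = fromℕ< (s≤s m≤n)
  a≡m : toℕ a ≡ m
  a≡m = Finₚ.toℕ-fromℕ< (s≤s m≤n)
  P? = occ≟ r ∘ insertHead a
  early : ∀ {τ} → (occ (insertHead a τ) ≡ r × first τ < m) ⇔ (occ τ ≡ r × first τ < m)
  early {τ} = mk⇔ (λ (o , lt) → trans (sym (insert lt)) o , lt) (λ (o , lt) → trans (insert lt) o , lt)
    where insert = λ lt → occ-insertHead-< a τ (subst (first τ <_) (sym a≡m) lt)
  late : ∀ {τ} → τ ∈ ps → (occ (insertHead a τ) ≡ r × ¬ first τ < m) ⇔ (occ τ N.+ m ≡ r × ¬ first τ < m)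
  late {τ} τ∈ = mk⇔ (λ (o , ¬lt) → trans (sym (insert ¬lt)) o , ¬lt) (λ (o , ¬lt) → trans (insert ¬lt) o , ¬lt)
    where
    insert : ¬ first τ < m → occ (insertHead a τ) ≡ occ τ N.+ m
    insert ¬lt = trans (occ-insertHead-≥ a τ∈ (subst (_≤ first τ) (sym a≡m) (ℕₚ.≮⇒≥ ¬lt)))
                       (cong (occ τ N.+_) a≡m)

vFirst-suc : ∀ r n m → m ≤ n → m ≤ r →
  vFirst r (suc n) m ≡ Σ< m (vFirst r n) + (V (r ∸ m) n - Σ< m (vFirst (r ∸ m) n))
vFirst-suc r n m m≤n m≤r = trans (vFirst-suc-split r n m m≤n)
  (cong (λ c → Σ< m (vFirst r n) + c)
        (trans (cong +_ (count-cong ((λ τ → occ τ N.+ m ℕₚ.≟ r) ∩? ∁? (first<? m)) (occ≟ (r ∸ m) ∩? ∁? (first<? m))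
                                    (permutations n) (λ _ → mk⇔ (Product.map₁ to) (Product.map₁ from))))
               (count-occ-first≥ (r ∸ m) n m)))
  where
  to : ∀ {o} → o N.+ m ≡ r → o ≡ r ∸ m
  to {o} eq = trans (sym (ℕₚ.m+n∸n≡m o m)) (cong (_∸ m) eq)
  from : ∀ {o} → o ≡ r ∸ m → o N.+ m ≡ r
  from eq = trans (cong (N._+ m) eq) (ℕₚ.m∸n+n≡m m≤r)

vFirst-suc-large : ∀ r n m → m ≤ n → r < m → vFirst r (suc n) m ≡ Σ< m (vFirst r n) + 0ℤ
vFirst-suc-large r n m m≤n r<m = trans (vFirst-suc-split r n m m≤n)
  (cong (λ c → Σ< m (vFirst r n) + + c)
        (count-none ((λ τ → occ τ N.+ m ℕₚ.≟ r) ∩? ∁? (first<? m)) (permutations n)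
                    (λ {τ} _ (eq , _) → ℕₚ.<⇒≱ r<m (subst (m ≤_) eq (ℕₚ.m≤n+m m (occ τ))))))

-- Powers of y = x/(1-x)

y^ : ℕ → Series
y^ = pow xOver1-x

xOver1-x-⊛ : ∀ (G : Series) n → (xOver1-x ⊛ G) n ≡ Σ< n G
xOver1-x-⊛ G n = begin
  sumTo n (λ k → xOver1-x k * G (n ∸ k))     ≡⟨ sumTo≡Σ< n _ ⟩
  Σ< (suc n) (λ k → xOver1-x k * G (n ∸ k))  ≡⟨ Σ<-head n _ ⟩
  0ℤ * G n + Σ< n (λ k → 1ℤ * G (n ∸ suc k)) ≡⟨ ℤₚ.+-identityˡ _ ⟩
  Σ< n (λ k → 1ℤ * G (n ∸ suc k))            ≡⟨ Σ<-cong n (λ k _ → ℤₚ.*-identityˡ (G (n ∸ suc k))) ⟩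
  Σ< n (λ k → G (n ∸ suc k))                 ≡⟨ Σ<-reverse n G ⟩
  Σ< n G                                     ∎
  where open ≡-Reasoning

y^-suc : ∀ k t → y^ (suc k) t ≡ Σ< t (y^ k)
y^-suc k = xOver1-x-⊛ (y^ k)

y^-pascal : ∀ k t → y^ (suc k) (suc t) ≡ y^ (suc k) t + y^ k t
y^-pascal k t = trans (y^-suc k (suc t)) (cong (_+ y^ k t) (sym (y^-suc k t)))

y^-pascal-pred : ∀ j m → y^ j (suc (suc m)) ≡ y^ j (suc m) + y^ (j ∸ 1) (suc m)
y^-pascal-pred zero    m = refl
y^-pascal-pred (suc j) m = y^-pascal j (suc m)

y^-binomial : ∀ k t → y^ (suc k) (suc t) ≡ + (t C k)
y^-binomial zero    zero    = refl
y^-binomial (suc k) zero    = trans (y^-suc (suc k) 1) (cong (λ s → 0ℤ + s) (y^-suc k 0))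
y^-binomial zero    (suc t) = trans (y^-pascal 0 (suc t)) (cong (_+ 0ℤ) (y^-binomial 0 t))
y^-binomial (suc k) (suc t) = begin
  y^ (suc (suc k)) (suc (suc t))                ≡⟨ y^-pascal (suc k) (suc t) ⟩
  y^ (suc (suc k)) (suc t) + y^ (suc k) (suc t) ≡⟨ cong₂ _+_ (y^-binomial (suc k) t) (y^-binomial k t) ⟩
  + (t C suc k) + + (t C k)                     ≡⟨ ℤₚ.pos-+ (t C suc k) (t C k) ⟨
  + (t C suc k N.+ t C k)                       ≡⟨ cong +_ (trans (ℕₚ.+-comm (t C suc k) (t C k))
                                                                   (nCk+nC[k+1]≡[n+1]C[k+1] t k)) ⟩
  + (suc t C suc k)                             ∎
  where open ≡-Reasoning

y^-below : ∀ {k t} → t < k → y^ k t ≡ 0ℤ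
y^-below {suc k} {zero}  _         = y^-suc k 0
y^-below {suc k} {suc t} (s≤s t<k) = trans (y^-binomial k t) (cong +_ (k>n⇒nCk≡0 t<k))

y^-sym : ∀ a b → y^ (suc a) (suc (a N.+ b)) ≡ y^ (suc b) (suc (a N.+ b))
y^-sym a b = begin
  y^ (suc a) (suc (a N.+ b))    ≡⟨ y^-binomial a (a N.+ b) ⟩
  + ((a N.+ b) C a)             ≡⟨ cong +_ (nCk≡nC[n∸k] (ℕₚ.m≤m+n a b)) ⟩
  + ((a N.+ b) C (a N.+ b ∸ a)) ≡⟨ cong (λ k → + ((a N.+ b) C k)) (ℕₚ.m+n∸m≡n a b) ⟩
  + ((a N.+ b) C b)             ≡⟨ y^-binomial b (a N.+ b) ⟨
  y^ (suc b) (suc (a N.+ b))    ∎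
  where open ≡-Reasoning

1+m+n∸m≡1+n : ∀ m n → suc (m N.+ n) ∸ m ≡ suc n
1+m+n∸m≡1+n m n = trans (cong (_∸ m) (sym (ℕₚ.+-suc m n))) (ℕₚ.m+n∸m≡n m (suc n))

-- C(n-c, n-j) = C(n-c, j-c) for c ≤ j; for j < c both sides vanish.
y^-reflect : ∀ {n j c} → c ≤ n → j ≤ n → y^ (suc n ∸ j) (suc n ∸ c) ≡ y^ (suc j ∸ c) (suc n ∸ c)
y^-reflect {n} {j} {c} c≤n j≤n with c N.≤? j
... | no c≰j = trans (y^-below (ℕₚ.∸-monoʳ-< j<c (ℕₚ.m≤n⇒m≤1+n c≤n))) (sym vanish)
  where
  j<c = ℕₚ.≰⇒> c≰j
  vanish : y^ (suc j ∸ c) (suc n ∸ c) ≡ 0ℤ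
  vanish rewrite ℕₚ.m≤n⇒m∸n≡0 j<c | ℕₚ.+-∸-assoc 1 c≤n = refl
... | yes c≤j with ℕₚ.m≤n⇒∃[o]m+o≡n c≤j | ℕₚ.m≤n⇒∃[o]m+o≡n j≤n
...   | b , refl | a , refl
  rewrite 1+m+n∸m≡1+n (c N.+ b) a | ℕₚ.+-assoc c b a | 1+m+n∸m≡1+n c (b N.+ a) | 1+m+n∸m≡1+n c b
  = sym (y^-sym b a)

y^-Δ : ∀ j m → y^ j (suc m) - y^ (suc j) (suc m) ≡ y^ (suc j) (suc (suc m)) - + 2 * y^ (suc j) (suc m)
y^-Δ j m = trans (ring (y^ (suc j) (suc m)) (y^ j (suc m)))
                 (cong (λ s → s - + 2 * y^ (suc j) (suc m)) (sym (y^-pascal j (suc m))))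
  where
  ring : ∀ a b → b - a ≡ a + b - + 2 * a
  ring = solve-∀

y^-Δ² : ∀ j m → y^ (j ∸ 1) (suc m) - y^ j (suc m) - y^ (suc j) (suc m)
              ≡ y^ (suc j) (suc (suc (suc m))) - + 3 * y^ (suc j) (suc (suc m)) + y^ (suc j) (suc m)
y^-Δ² j m = begin
  d - b - a
    ≡⟨ ring a b d ⟩
  a + b + (b + d) - + 3 * (a + b) + a
    ≡⟨ cong (λ s → s - + 3 * (a + b) + a) (cong₂ _+_ (sym (y^-pascal j (suc m))) (sym (y^-pascal-pred j m))) ⟩
  y^ (suc j) (suc (suc m)) + y^ j (suc (suc m)) - + 3 * (a + b) + a
    ≡⟨ cong₂ (λ s t → s - + 3 * t + a) (sym (y^-pascal j (suc (suc m)))) (sym (y^-pascal j (suc m))) ⟩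
  y^ (suc j) (suc (suc (suc m))) - + 3 * y^ (suc j) (suc (suc m)) + a ∎
  where
  open ≡-Reasoning
  a = y^ (suc j) (suc m)
  b = y^ j (suc m)
  d = y^ (j ∸ 1) (suc m)
  ring : ∀ a b d → d - b - a ≡ a + b + (b + d) - + 3 * (a + b) + a
  ring = solve-∀

-- A triangular recurrence with finitely many source columns

δ : ℕ → ℕ → ℤ
δ zero    m       = one m
δ (suc c) zero    = 0ℤ
δ (suc c) (suc m) = δ c m

Σ<-δ : ∀ K m (f : ℕ → ℤ) → (K ≤ m → f m ≡ 0ℤ) → Σ< K (λ c → δ c m * f c) ≡ f m
Σ<-δ zero    m       f f≡0 = sym (f≡0 z≤n)
Σ<-δ (suc K) zero    f _   = begin
  Σ< (suc K) (λ c → δ c 0 * f c)         ≡⟨ Σ<-head K _ ⟩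
  1ℤ * f 0 + Σ< K (λ c → 0ℤ * f (suc c)) ≡⟨ cong₂ _+_ (ℤₚ.*-identityˡ (f 0))
                                                       (Σ<-zero K (λ c _ → ℤₚ.*-zeroˡ (f (suc c)))) ⟩
  f 0 + 0ℤ                               ≡⟨ ℤₚ.+-identityʳ (f 0) ⟩
  f 0                                    ∎
  where open ≡-Reasoning
Σ<-δ (suc K) (suc m) f f≡0 = begin
  Σ< (suc K) (λ c → δ c (suc m) * f c)      ≡⟨ Σ<-head K _ ⟩
  0ℤ * f 0 + Σ< K (λ c → δ c m * f (suc c)) ≡⟨ cong₂ _+_ (ℤₚ.*-zeroˡ (f 0))
                                                          (Σ<-δ K m (f ∘ suc) (f≡0 ∘ s≤s)) ⟩
  0ℤ + f (suc m)                            ≡⟨ ℤₚ.+-identityˡ (f (suc m)) ⟩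
  f (suc m)                                 ∎
  where open ≡-Reasoning

-- column σ c n m solves the recurrence of `Triangle` whose only source σ sits in column c.
module _ (σ : ℕ → ℤ) where

  column : ℕ → ℕ → ℕ → ℤ
  column zero    n t       = Σ< (suc n) (λ i → σ i * y^ (n ∸ i) t)
  column (suc c) n zero    = 0ℤ
  column (suc c) n (suc m) = column c n m

  Σ<-column₀ : ∀ n L → Σ< L (column 0 n) ≡ Σ< (suc n) (λ i → σ i * y^ (suc (n ∸ i)) L)
  Σ<-column₀ n L = trans (Σ<-comm L (suc n) (λ t i → σ i * y^ (n ∸ i) t))
    (Σ<-cong (suc n) (λ i _ → trans (Σ<-*ˡ L (σ i) (y^ (n ∸ i))) (cong (σ i *_) (sym (y^-suc (n ∸ i) L)))))

  column-suc : ∀ c n m → column c (suc n) m ≡ Σ< m (column c n) + δ c m * σ (suc n)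
  column-suc zero n t = begin
    Σ< (suc n) (λ i → σ i * y^ (suc n ∸ i) t) + σ (suc n) * y^ (suc n ∸ suc n) t
      ≡⟨ cong₂ _+_ (Σ<-cong (suc n) (λ i i≤n → cong (λ k → σ i * y^ k t) (ℕₚ.+-∸-assoc 1 (ℕₚ.≤-pred i≤n))))
                   (trans (cong (λ k → σ (suc n) * y^ k t) (ℕₚ.n∸n≡0 n)) (ℤₚ.*-comm (σ (suc n)) (one t))) ⟩
    Σ< (suc n) (λ i → σ i * y^ (suc (n ∸ i)) t) + one t * σ (suc n)
      ≡⟨ cong (_+ one t * σ (suc n)) (Σ<-column₀ n t) ⟨
    Σ< t (column 0 n) + one t * σ (suc n) ∎
    where open ≡-Reasoning
  column-suc (suc c) n zero    = sym (trans (ℤₚ.+-identityˡ _) (ℤₚ.*-zeroˡ (σ (suc n))))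
  column-suc (suc c) n (suc m) = trans (column-suc c n m)
    (cong (_+ δ c m * σ (suc n)) (sym (trans (Σ<-head m (column (suc c) n)) (ℤₚ.+-identityˡ (Σ< m (column c n))))))

  Σ<-column : ∀ c n {L} → c ≤ L → Σ< L (column c n) ≡ Σ< (L ∸ c) (column 0 n)
  Σ<-column zero    n         _         = refl
  Σ<-column (suc c) n {suc L} (s≤s c≤L) = trans (trans (Σ<-head L _) (ℤₚ.+-identityˡ _)) (Σ<-column c n c≤L)

  Σ<-column-row : σ 0 ≡ 0ℤ → ∀ c n → c ≤ suc n →
    Σ< (suc n) (column c (suc n)) ≡ Σ< (suc n) (λ j → σ (suc j) * y^ (suc n ∸ j) (suc n ∸ c))
  Σ<-column-row σ0≡0 c n c≤1+n = begin
    Σ< (suc n) (column c (suc n))                                      ≡⟨ Σ<-column c (suc n) c≤1+n ⟩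
    Σ< (suc n ∸ c) (column 0 (suc n))                                  ≡⟨ Σ<-column₀ (suc n) (suc n ∸ c) ⟩
    Σ< (suc (suc n)) (λ i → σ i * y^ (suc (suc n ∸ i)) (suc n ∸ c))   ≡⟨ Σ<-head (suc n) _ ⟩
    σ 0 * y^ (suc (suc n)) (suc n ∸ c) + Σ< (suc n) (λ j → σ (suc j) * y^ (suc (n ∸ j)) (suc n ∸ c))
      ≡⟨ cong₂ _+_ (trans (cong (_* y^ (suc (suc n)) (suc n ∸ c)) σ0≡0) (ℤₚ.*-zeroˡ (y^ (suc (suc n)) (suc n ∸ c))))
                   (Σ<-cong (suc n) (λ j j≤n → cong (λ k → σ (suc j) * y^ k (suc n ∸ c))
                                                     (sym (ℕₚ.+-∸-assoc 1 (ℕₚ.≤-pred j≤n))))) ⟩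
    0ℤ + Σ< (suc n) (λ j → σ (suc j) * y^ (suc n ∸ j) (suc n ∸ c))    ≡⟨ ℤₚ.+-identityˡ _ ⟩
    Σ< (suc n) (λ j → σ (suc j) * y^ (suc n ∸ j) (suc n ∸ c))         ∎
    where open ≡-Reasoning

-- The recurrence is linear in the source s, so H superposes the columns of s.
module Triangle (K : ℕ) (s : ℕ → ℕ → ℤ)
                (s-zero : ∀ c → s 0 c ≡ 0ℤ) (s-narrow : ∀ i c → K ≤ c → s i c ≡ 0ℤ)
                (H : ℕ → ℕ → ℤ) (H-suc : ∀ n m → m ≤ n → H (suc n) m ≡ Σ< m (H n) + s (suc n) m) where

  solution : ℕ → ℕ → ℤ
  solution n m = Σ< K (λ c → column (λ i → s i c) c n m)

  solution-suc : ∀ n m → solution (suc n) m ≡ Σ< m (solution n) + s (suc n) m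
  solution-suc n m = begin
    Σ< K (λ c → column (λ i → s i c) c (suc n) m)
      ≡⟨ Σ<-cong K (λ c _ → column-suc (λ i → s i c) c n m) ⟩
    Σ< K (λ c → Σ< m (column (λ i → s i c) c n) + δ c m * s (suc n) c)
      ≡⟨ Σ<-distrib-+ K _ _ ⟩
    Σ< K (λ c → Σ< m (column (λ i → s i c) c n)) + Σ< K (λ c → δ c m * s (suc n) c)
      ≡⟨ cong₂ _+_ (Σ<-comm K m _) (Σ<-δ K m (s (suc n)) (s-narrow (suc n) m)) ⟩
    Σ< m (solution n) + s (suc n) m ∎
    where open ≡-Reasoning

  H≡solution : ∀ n m → m ≤ n → H (suc n) m ≡ solution (suc n) m
  H≡solution n m m≤n = begin
    H (suc n) m                      ≡⟨ H-suc n m m≤n ⟩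
    Σ< m (H n) + s (suc n) m
      ≡⟨ cong (_+ s (suc n) m) (Σ<-cong m (λ t t<m → previous n t (ℕₚ.<-≤-trans t<m m≤n))) ⟩
    Σ< m (solution n) + s (suc n) m  ≡⟨ solution-suc n m ⟨
    solution (suc n) m               ∎
    where
    open ≡-Reasoning
    previous : ∀ n t → t < n → H n t ≡ solution n t
    previous (suc n) t (s≤s t≤n) = H≡solution n t t≤n

  row-sum : ∀ n → K ≤ suc n →
    Σ< (suc n) (H (suc n)) ≡ Σ< K (λ c → Σ< (suc n) (λ j → s (suc j) c * y^ (suc n ∸ j) (suc n ∸ c)))
  row-sum n K≤1+n = begin
    Σ< (suc n) (H (suc n))         ≡⟨ Σ<-cong (suc n) (λ m m≤n → H≡solution n m (ℕₚ.≤-pred m≤n)) ⟩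
    Σ< (suc n) (solution (suc n))  ≡⟨ Σ<-comm (suc n) K _ ⟩
    Σ< K (λ c → Σ< (suc n) (column (λ i → s i c) c (suc n)))
      ≡⟨ Σ<-cong K (λ c c<K → Σ<-column-row (λ i → s i c) (s-zero c) c n
                                             (ℕₚ.<⇒≤ (ℕₚ.<-≤-trans c<K K≤1+n))) ⟩
    Σ< K (λ c → Σ< (suc n) (λ j → s (suc j) c * y^ (suc n ∸ j) (suc n ∸ c))) ∎
    where open ≡-Reasoning

-- Coefficients of the right-hand side

shift : Series → Series
shift F zero    = 0ℤ
shift F (suc i) = F i

Σ<-shift : ∀ n (F : Series) → Σ< (suc n) (shift F) ≡ Σ< n F
Σ<-shift n F = trans (Σ<-head n (shift F)) (ℤₚ.+-identityˡ (Σ< n F))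

poly-[]-⊛ : ∀ (F : Series) t → (poly [] ⊛ F) t ≡ 0ℤ
poly-[]-⊛ F t = trans (sumTo≡Σ< t _) (Σ<-zero (suc t) (λ k _ → ℤₚ.*-zeroˡ (F (t ∸ k))))

poly-∷-⊛ : ∀ c cs (F : Series) t → (poly (c ∷ cs) ⊛ F) t ≡ c * F t + (poly cs ⊛ shift F) t
poly-∷-⊛ c cs F zero    = sym (trans (cong (λ s → c * F 0 + s) (ℤₚ.*-zeroʳ (poly cs 0))) (ℤₚ.+-identityʳ (c * F 0)))
poly-∷-⊛ c cs F (suc t) = begin
  sumTo (suc t) (λ k → poly (c ∷ cs) k * F (suc t ∸ k))     ≡⟨ trans (sumTo≡Σ< (suc t) _) (Σ<-head (suc t) _) ⟩
  c * F (suc t) + Σ< (suc t) (λ k → poly cs k * F (t ∸ k))  ≡⟨ cong (λ s → c * F (suc t) + s) shifted ⟩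
  c * F (suc t) + Σ< (suc (suc t)) g                         ≡⟨ cong (λ s → c * F (suc t) + s) (sumTo≡Σ< (suc t) g) ⟨
  c * F (suc t) + (poly cs ⊛ shift F) (suc t)                ∎
  where
  open ≡-Reasoning
  g = λ k → poly cs k * shift F (suc t ∸ k)
  last : g (suc t) ≡ 0ℤ
  last = trans (cong (λ i → poly cs (suc t) * shift F i) (ℕₚ.n∸n≡0 t)) (ℤₚ.*-zeroʳ (poly cs (suc t)))
  shifted : Σ< (suc t) (λ k → poly cs k * F (t ∸ k)) ≡ Σ< (suc (suc t)) g
  shifted = begin
    Σ< (suc t) (λ k → poly cs k * F (t ∸ k))
      ≡⟨ Σ<-cong (suc t) (λ k k≤t → cong (λ i → poly cs k * shift F i) (sym (ℕₚ.+-∸-assoc 1 (ℕₚ.≤-pred k≤t)))) ⟩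
    Σ< (suc t) g         ≡⟨ ℤₚ.+-identityʳ (Σ< (suc t) g) ⟨
    Σ< (suc t) g + 0ℤ    ≡⟨ cong (λ s → Σ< (suc t) g + s) last ⟨
    Σ< (suc (suc t)) g   ∎

⊛-1-2x : ∀ (F : Series) t → (poly (+ 1 ∷ - (+ 2) ∷ []) ⊛ F) t ≡ F t - + 2 * shift F t
⊛-1-2x F t = begin
  (poly (+ 1 ∷ - (+ 2) ∷ []) ⊛ F) t
    ≡⟨ poly-∷-⊛ _ _ F t ⟩
  + 1 * F t + (poly (- (+ 2) ∷ []) ⊛ shift F) t
    ≡⟨ cong (λ s → + 1 * F t + s) (poly-∷-⊛ _ _ (shift F) t) ⟩
  + 1 * F t + (- (+ 2) * shift F t + (poly [] ⊛ shift (shift F)) t)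
    ≡⟨ cong (λ s → + 1 * F t + (- (+ 2) * shift F t + s)) (poly-[]-⊛ (shift (shift F)) t) ⟩
  + 1 * F t + (- (+ 2) * shift F t + 0ℤ)
    ≡⟨ ring (F t) (shift F t) ⟩
  F t - + 2 * shift F t ∎
  where
  open ≡-Reasoning
  ring : ∀ a b → + 1 * a + (- (+ 2) * b + 0ℤ) ≡ a - + 2 * b
  ring = solve-∀

⊛-1-3x+x² : ∀ (F : Series) t →
  (poly (+ 1 ∷ - (+ 3) ∷ + 1 ∷ []) ⊛ F) t ≡ F t - + 3 * shift F t + shift (shift F) t
⊛-1-3x+x² F t = begin
  (poly (+ 1 ∷ - (+ 3) ∷ + 1 ∷ []) ⊛ F) t
    ≡⟨ poly-∷-⊛ _ _ F t ⟩
  + 1 * F t + (poly (- (+ 3) ∷ + 1 ∷ []) ⊛ shift F) t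
    ≡⟨ cong (λ s → + 1 * F t + s) (poly-∷-⊛ _ _ (shift F) t) ⟩
  + 1 * F t + (- (+ 3) * shift F t + (poly (+ 1 ∷ []) ⊛ shift (shift F)) t)
    ≡⟨ cong (λ s → + 1 * F t + (- (+ 3) * shift F t + s)) (poly-∷-⊛ _ _ (shift (shift F)) t) ⟩
  + 1 * F t + (- (+ 3) * shift F t + (+ 1 * shift (shift F) t + (poly [] ⊛ shift (shift (shift F))) t))
    ≡⟨ cong (λ s → + 1 * F t + (- (+ 3) * shift F t + (+ 1 * shift (shift F) t + s)))
            (poly-[]-⊛ (shift (shift (shift F))) t) ⟩
  + 1 * F t + (- (+ 3) * shift F t + (+ 1 * shift (shift F) t + 0ℤ))
    ≡⟨ ring (F t) (shift F t) (shift (shift F) t) ⟩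
  F t - + 3 * shift F t + shift (shift F) t ∎
  where
  open ≡-Reasoning
  ring : ∀ a b c → + 1 * a + (- (+ 3) * b + (+ 1 * c + 0ℤ)) ≡ a - + 3 * b + c
  ring = solve-∀

Σ<-1-2x : ∀ n (F : Series) → Σ< (suc n) (λ t → F t - + 2 * shift F t) ≡ Σ< (suc n) F - + 2 * Σ< n F
Σ<-1-2x n F = trans (Σ<-distrib-- (suc n) F _)
  (cong (λ s → Σ< (suc n) F - s) (trans (Σ<-*ˡ (suc n) (+ 2) (shift F)) (cong (+ 2 *_) (Σ<-shift n F))))

Σ<-1-3x+x² : ∀ n (F : Series) → Σ< (suc (suc n)) (λ t → F t - + 3 * shift F t + shift (shift F) t)
                               ≡ Σ< (suc (suc n)) F - + 3 * Σ< (suc n) F + Σ< n F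
Σ<-1-3x+x² n F = trans (Σ<-distrib-+ (suc (suc n)) _ (shift (shift F)))
  (cong₂ _+_ (trans (Σ<-distrib-- (suc (suc n)) F _)
                    (cong (λ s → Σ< (suc (suc n)) F - s)
                          (trans (Σ<-*ˡ (suc (suc n)) (+ 3) (shift F)) (cong (+ 3 *_) (Σ<-shift (suc n) F)))))
             (trans (Σ<-shift (suc n) (shift F)) (Σ<-shift n F)))

Σy : ℕ → Series → ℕ → ℤ
Σy M F L = Σ< M (λ k → F k * y^ (suc k) L)

Σ<-compose : ∀ (F : Series) {L M} → L ≤ M → Σ< L (compose F xOver1-x) ≡ Σy M F L
Σ<-compose F {L} {M} L≤M = begin
  Σ< L (λ t → sumTo t (λ k → F k * y^ k t))
    ≡⟨ Σ<-cong L (λ t t<L → trans (sumTo≡Σ< t _)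
                                  (sym (Σ<-extend _ (ℕₚ.≤-trans t<L L≤M) (λ k t<k _ → vanish t<k)))) ⟩
  Σ< L (λ t → Σ< M (λ k → F k * y^ k t))
    ≡⟨ Σ<-comm L M _ ⟩
  Σ< M (λ k → Σ< L (λ t → F k * y^ k t))
    ≡⟨ Σ<-cong M (λ k _ → trans (Σ<-*ˡ L (F k) (y^ k)) (cong (F k *_) (sym (y^-suc k L)))) ⟩
  Σy M F L ∎
  where
  open ≡-Reasoning
  vanish : ∀ {k t} → t < k → F k * y^ k t ≡ 0ℤ
  vanish {k} t<k = trans (cong (F k *_) (y^-below t<k)) (ℤₚ.*-zeroʳ (F k))

rhs : Series → Series → Series → Series
rhs F₂ F₁ F₀ = xOver1-x ⊛ (compose F₂ xOver1-x
                            ⊕ poly (+ 1 ∷ - (+ 2) ∷ []) ⊛ compose F₁ xOver1-x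
                            ⊕ poly (+ 1 ∷ - (+ 3) ∷ + 1 ∷ []) ⊛ compose F₀ xOver1-x)
               ⊖ poly (+ 0 ∷ + 1 ∷ []) ⊕ poly (+ 0 ∷ + 0 ∷ + 1 ∷ [])

rhs-coefficient : ∀ F₂ F₁ F₀ m → let n = suc (suc m) ; M = suc n in
  rhs F₂ F₁ F₀ M ≡ Σy M F₂ M + (Σy M F₁ M - + 2 * Σy M F₁ n) + (Σy M F₀ M - + 3 * Σy M F₀ n + Σy M F₀ (suc m))
rhs-coefficient F₂ F₁ F₀ m = begin
  (xOver1-x ⊛ G) M - 0ℤ + 0ℤ
    ≡⟨ trans (ℤₚ.+-identityʳ _) (ℤₚ.+-identityʳ _) ⟩
  (xOver1-x ⊛ G) M
    ≡⟨ xOver1-x-⊛ G M ⟩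
  Σ< M G
    ≡⟨ Σ<-cong M (λ t _ → cong₂ _+_ (cong (λ s → C₂ t + s) (⊛-1-2x C₁ t)) (⊛-1-3x+x² C₀ t)) ⟩
  Σ< M (λ t → C₂ t + Q₁ t + Q₀ t)
    ≡⟨ trans (Σ<-distrib-+ M _ Q₀) (cong (_+ Σ< M Q₀) (Σ<-distrib-+ M C₂ Q₁)) ⟩
  Σ< M C₂ + Σ< M Q₁ + Σ< M Q₀
    ≡⟨ cong₂ _+_ (cong (λ s → Σ< M C₂ + s) (Σ<-1-2x n C₁)) (Σ<-1-3x+x² (suc m) C₀) ⟩
  Σ< M C₂ + (Σ< M C₁ - + 2 * Σ< n C₁) + (Σ< M C₀ - + 3 * Σ< n C₀ + Σ< (suc m) C₀)
    ≡⟨ cong₂ _+_ (cong₂ _+_ (Σ<-compose F₂ M≤M) (cong₂ _-_ (Σ<-compose F₁ M≤M) (cong (+ 2 *_) (Σ<-compose F₁ n≤M))))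
                 (cong₂ _+_ (cong₂ _-_ (Σ<-compose F₀ M≤M) (cong (+ 3 *_) (Σ<-compose F₀ n≤M))) (Σ<-compose F₀ m+1≤M)) ⟩
  Σy M F₂ M + (Σy M F₁ M - + 2 * Σy M F₁ n) + (Σy M F₀ M - + 3 * Σy M F₀ n + Σy M F₀ (suc m)) ∎
  where
  open ≡-Reasoning
  n = suc (suc m)
  M = suc n
  C₂ = compose F₂ xOver1-x
  C₁ = compose F₁ xOver1-x
  C₀ = compose F₀ xOver1-x
  G = C₂ ⊕ poly (+ 1 ∷ - (+ 2) ∷ []) ⊛ C₁ ⊕ poly (+ 1 ∷ - (+ 3) ∷ + 1 ∷ []) ⊛ C₀
  Q₁ = λ t → C₁ t - + 2 * shift C₁ t
  Q₀ = λ t → C₀ t - + 3 * shift C₀ t + shift (shift C₀) t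
  M≤M : M ≤ M
  M≤M = ℕₚ.≤-refl
  n≤M = ℕₚ.n≤1+n n
  m+1≤M = ℕₚ.≤-trans (ℕₚ.n≤1+n (suc m)) n≤M

Σ<-shift-* : ∀ n (F X : ℕ → ℤ) → X (suc n) ≡ 0ℤ →
  Σ< (suc n) (λ j → shift F j * X j) ≡ Σ< (suc n) (λ j → F j * X (suc j))
Σ<-shift-* n F X X≡0 = begin
  Σ< (suc n) (λ j → shift F j * X j)       ≡⟨ Σ<-head n _ ⟩
  0ℤ * X 0 + Σ< n (λ j → F j * X (suc j))  ≡⟨ cong (_+ Σ< n (λ j → F j * X (suc j))) (ℤₚ.*-zeroˡ (X 0)) ⟩
  0ℤ + Σ< n (λ j → F j * X (suc j))        ≡⟨ ℤₚ.+-comm 0ℤ (Σ< n (λ j → F j * X (suc j))) ⟩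
  Σ< n (λ j → F j * X (suc j)) + 0ℤ        ≡⟨ cong (λ s → Σ< n (λ j → F j * X (suc j)) + s)
                                                   (trans (cong (F n *_) X≡0) (ℤₚ.*-zeroʳ (F n))) ⟨
  Σ< (suc n) (λ j → F j * X (suc j))       ∎
  where open ≡-Reasoning

-- Summation by parts moves the shifts of F onto the kernel, where Pascal's rule applies.
Σ<-Δ·y^ : ∀ (F : Series) m → let n = suc m ; M = suc n in
  Σ< M (λ j → (F j - shift F j) * y^ j n) ≡ Σy M F M - + 2 * Σy M F n
Σ<-Δ·y^ F m = begin
  Σ< M (λ j → (F j - shift F j) * X j)
    ≡⟨ trans (Σ<-cong M (λ j _ → distribʳ (F j) (shift F j) (X j))) (Σ<-distrib-- M _ _) ⟩
  Σ< M (λ j → F j * X j) - Σ< M (λ j → shift F j * X j)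
    ≡⟨ cong (λ s → Σ< M (λ j → F j * X j) - s) (Σ<-shift-* n F X (y^-below (ℕₚ.n<1+n n))) ⟩
  Σ< M (λ j → F j * X j) - Σ< M (λ j → F j * X (suc j))
    ≡⟨ trans (sym (Σ<-distrib-- M _ _))
             (Σ<-cong M (λ j _ → trans (distribˡ (F j) (X j) (X (suc j))) (cong (F j *_) (y^-Δ j m)))) ⟩
  Σ< M (λ j → F j * (y^ (suc j) M - + 2 * y^ (suc j) n))
    ≡⟨ trans (Σ<-cong M (λ j _ → scale (F j) (y^ (suc j) M) (y^ (suc j) n))) (Σ<-distrib-- M _ _) ⟩
  Σy M F M - Σ< M (λ j → + 2 * (F j * y^ (suc j) n))
    ≡⟨ cong (λ s → Σy M F M - s) (Σ<-*ˡ M (+ 2) _) ⟩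
  Σy M F M - + 2 * Σy M F n ∎
  where
  open ≡-Reasoning
  n = suc m
  M = suc n
  X = λ j → y^ j n
  distribʳ : ∀ a b x → (a - b) * x ≡ a * x - b * x
  distribʳ = solve-∀
  distribˡ : ∀ a x y → a * x - a * y ≡ a * (x - y)
  distribˡ = solve-∀
  scale : ∀ a x y → a * (x - + 2 * y) ≡ a * x - + 2 * (a * y)
  scale = solve-∀

Σ<-Δ²·y^ : ∀ (F : Series) m → let n = suc (suc m) ; M = suc n in
  Σ< M (λ j → (F j - shift F j - shift (shift F) j - one j) * y^ (j ∸ 1) (suc m))
    ≡ Σy M F M - + 3 * Σy M F n + Σy M F (suc m)
Σ<-Δ²·y^ F m = begin
  Σ< M (λ j → (F j - shift F j - shift (shift F) j - one j) * X j)
    ≡⟨ Σ<-cong M (λ j _ → distribʳ (F j) (shift F j) (shift (shift F) j) (one j) (X j)) ⟩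
  Σ< M (λ j → F j * X j - shift F j * X j - shift (shift F) j * X j - one j * X j)
    ≡⟨ trans (Σ<-distrib-- M _ _)
             (cong₂ _-_ (trans (Σ<-distrib-- M _ _) (cong (_- Σ< M (λ j → shift (shift F) j * X j)) (Σ<-distrib-- M _ _)))
                        (Σ<-zero M (λ j _ → one-X j))) ⟩
  Σ< M (λ j → F j * X j) - Σ< M (λ j → shift F j * X j) - Σ< M (λ j → shift (shift F) j * X j) - 0ℤ
    ≡⟨ cong (_- 0ℤ) (cong₂ _-_ (cong (λ s → Σ< M (λ j → F j * X j) - s) (Σ<-shift-* n F X X-M))
                               (trans (Σ<-shift-* n (shift F) X X-M) (Σ<-shift-* n F (X ∘ suc) X-1+M))) ⟩
  Σ< M (λ j → F j * X j) - Σ< M (λ j → F j * X (suc j)) - Σ< M (λ j → F j * X (suc (suc j))) - 0ℤ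
    ≡⟨ trans (ℤₚ.+-identityʳ _)
             (sym (trans (Σ<-distrib-- M _ _) (cong (_- Σ< M (λ j → F j * X (suc (suc j)))) (Σ<-distrib-- M _ _)))) ⟩
  Σ< M (λ j → F j * X j - F j * X (suc j) - F j * X (suc (suc j)))
    ≡⟨ Σ<-cong M (λ j _ → trans (distribˡ (F j) (X j) (X (suc j)) (X (suc (suc j)))) (cong (F j *_) (y^-Δ² j m))) ⟩
  Σ< M (λ j → F j * (y^ (suc j) M - + 3 * y^ (suc j) n + y^ (suc j) (suc m)))
    ≡⟨ Σ<-cong M (λ j _ → scale (F j) (y^ (suc j) M) (y^ (suc j) n) (y^ (suc j) (suc m))) ⟩
  Σ< M (λ j → F j * y^ (suc j) M - + 3 * (F j * y^ (suc j) n) + F j * y^ (suc j) (suc m))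
    ≡⟨ trans (Σ<-distrib-+ M _ _)
             (cong (_+ Σy M F (suc m)) (trans (Σ<-distrib-- M _ _) (cong (λ s → Σy M F M - s) (Σ<-*ˡ M (+ 3) _)))) ⟩
  Σy M F M - + 3 * Σy M F n + Σy M F (suc m) ∎
  where
  open ≡-Reasoning
  n = suc (suc m)
  M = suc n
  X = λ j → y^ (j ∸ 1) (suc m)
  X-M : X M ≡ 0ℤ
  X-M = y^-below (ℕₚ.n<1+n (suc m))
  X-1+M : X (suc M) ≡ 0ℤ
  X-1+M = y^-below (ℕₚ.m<n⇒m<1+n (ℕₚ.n<1+n (suc m)))
  one-X : ∀ j → one j * X j ≡ 0ℤ
  one-X zero    = ℤₚ.*-zeroʳ 1ℤ
  one-X (suc j) = ℤₚ.*-zeroˡ (X (suc j))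
  distribʳ : ∀ a b c d x → (a - b - c - d) * x ≡ a * x - b * x - c * x - d * x
  distribʳ = solve-∀
  distribˡ : ∀ a x y z → a * x - a * y - a * z ≡ a * (x - y - z)
  distribˡ = solve-∀
  scale : ∀ a x y z → a * (x - + 3 * y + z) ≡ a * x - + 3 * (a * y) + a * z
  scale = solve-∀

-- Two occurrences

-- v_{2-c}(j) - Σ_{t<c} v_{2-c}(j; t), the source term of vFirst-suc for r = 2,
-- made explicit by vFirst₁-0, vFirst₀-0 and vFirst₀-1.
source : ℕ → ℕ → ℤ
source zero    _                   = 0ℤ
source (suc j) 0                   = V 2 j
source (suc j) 1                   = V 1 j - shift (V 1) j
source (suc j) 2                   = V 0 j - shift (V 0) j - shift (shift (V 0)) j - one j
source (suc j) (suc (suc (suc _))) = 0ℤ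

source-narrow : ∀ i c → 3 ≤ c → source i c ≡ 0ℤ
source-narrow zero    c                   _              = refl
source-narrow (suc i) (suc (suc (suc c))) _              = refl
source-narrow (suc i) (suc zero)          (s≤s ())
source-narrow (suc i) (suc (suc zero))    (s≤s (s≤s ()))

vFirst-zero : ∀ r n → vFirst r (suc n) 0 ≡ V r n
vFirst-zero r n = trans (vFirst-suc r n 0 z≤n z≤n) (trans (ℤₚ.+-identityˡ _) (ℤₚ.+-identityʳ (V r n)))

vFirst₁-0 : ∀ n → vFirst 1 n 0 ≡ shift (V 1) n
vFirst₁-0 zero    = refl
vFirst₁-0 (suc n) = vFirst-zero 1 n

vFirst₀-0 : ∀ n → vFirst 0 n 0 ≡ shift (V 0) n + one n
vFirst₀-0 zero    = refl
vFirst₀-0 (suc n) = trans (vFirst-zero 0 n) (sym (ℤₚ.+-identityʳ (V 0 n)))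

vFirst₀-1 : ∀ n → vFirst 0 n 1 ≡ shift (shift (V 0)) n
vFirst₀-1 zero          = refl
vFirst₀-1 (suc zero)    = refl
vFirst₀-1 (suc (suc n)) = trans (vFirst-suc-large 0 (suc n) 1 (s≤s z≤n) (s≤s z≤n))
                                (trans (ℤₚ.+-identityʳ _) (trans (ℤₚ.+-identityˡ _) (vFirst-zero 0 n)))

vFirst₂-suc : ∀ n m → m ≤ n → vFirst 2 (suc n) m ≡ Σ< m (vFirst 2 n) + source (suc n) m
vFirst₂-suc n zero m≤n =
  trans (vFirst-suc 2 n 0 m≤n z≤n) (cong (λ s → 0ℤ + s) (ℤₚ.+-identityʳ (V 2 n)))
vFirst₂-suc n (suc zero) m≤n =
  trans (vFirst-suc 2 n 1 m≤n (s≤s z≤n))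
        (cong (λ s → Σ< 1 (vFirst 2 n) + (V 1 n - s)) (trans (ℤₚ.+-identityˡ _) (vFirst₁-0 n)))
vFirst₂-suc n (suc (suc zero)) m≤n =
  trans (vFirst-suc 2 n 2 m≤n (s≤s (s≤s z≤n)))
        (cong (λ s → Σ< 2 (vFirst 2 n) + s)
              (trans (cong₂ (λ s t → V 0 n - (0ℤ + s + t)) (vFirst₀-0 n) (vFirst₀-1 n))
                     (regroup (V 0 n) (shift (V 0) n) (one n) (shift (shift (V 0)) n))))
  where
  regroup : ∀ a b c d → a - (0ℤ + (b + c) + d) ≡ a - b - d - c
  regroup = solve-∀
vFirst₂-suc n (suc (suc (suc m))) m≤n = vFirst-suc-large 2 n (3 N.+ m) m≤n (s≤s (s≤s (s≤s z≤n)))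

V₂-coefficient : ∀ m → let M = suc (suc (suc m)) in V 2 M ≡ rhs (V 2) (V 1) (V 0) M
V₂-coefficient m = begin
  V 2 M
    ≡⟨ V≡Σ<vFirst 2 n ⟩
  Σ< M (vFirst 2 M)
    ≡⟨ row-sum n (s≤s (s≤s (s≤s z≤n))) ⟩
  Σ< 3 (λ c → Σ< M (λ j → source (suc j) c * y^ (M ∸ j) (M ∸ c)))
    ≡⟨ Σ<-cong 3 (λ c c<3 → Σ<-cong M (λ j j<M →
         cong (source (suc j) c *_) (y^-reflect (c≤n c<3) (ℕₚ.≤-pred j<M)))) ⟩
  0ℤ + Σy M (V 2) M + Σ< M (λ j → source (suc j) 1 * y^ j n) + Σ< M (λ j → source (suc j) 2 * y^ (j ∸ 1) (suc m))
    ≡⟨ cong₂ _+_ (cong₂ _+_ (ℤₚ.+-identityˡ (Σy M (V 2) M)) (Σ<-Δ·y^ (V 1) (suc m))) (Σ<-Δ²·y^ (V 0) m) ⟩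
  Σy M (V 2) M + (Σy M (V 1) M - + 2 * Σy M (V 1) n) + (Σy M (V 0) M - + 3 * Σy M (V 0) n + Σy M (V 0) (suc m))
    ≡⟨ rhs-coefficient (V 2) (V 1) (V 0) m ⟨
  rhs (V 2) (V 1) (V 0) M ∎
  where
  open ≡-Reasoning
  open Triangle 3 source (λ _ → refl) source-narrow (vFirst 2) vFirst₂-suc using (row-sum)
  n = suc (suc m)
  M = suc n
  c≤n : ∀ {c} → c < 3 → c ≤ n
  c≤n c<3 = ℕₚ.≤-trans (ℕₚ.≤-pred c<3) (s≤s (s≤s z≤n))

theorem5 : ∀ (n : ℕ) →
    V 2 n ≡
      (xOver1-x ⊛ (compose (V 2) xOver1-x
                   ⊕ poly (+ 1 ∷ - (+ 2) ∷ []) ⊛ compose (V 1) xOver1-x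
                   ⊕ poly (+ 1 ∷ - (+ 3) ∷ + 1 ∷ []) ⊛ compose (V 0) xOver1-x)
       ⊖ poly (+ 0 ∷ + 1 ∷ []) ⊕ poly (+ 0 ∷ + 0 ∷ + 1 ∷ [])) n
theorem5 zero                = refl
theorem5 (suc zero)          = refl
theorem5 (suc (suc zero))    = refl
theorem5 (suc (suc (suc m))) = V₂-coefficient m
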